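{- Let $(V,c)$ be a metric space, let $\mathcal{F}\subseteq V$ be a set of $k$ initial facility locations, let $S=\{s_i: i\in\mathcal{F}\}$ be a set of $k$ distinct locations such that the assignment $i\mapsto s_i$ is a minimum-cost perfect matching between $\mathcal{F}$ and $S$ (with respect to cost $c$), and let $o_i\in V$ ($i\in\mathcal{F}$) be arbitrary locations. For $v\in V$ let $\sigma(v)$ be a location in $S$ nearest to $v$. Let $i_1,\dots,i_m$ be distinct facilities such that $\sigma(o_{i_\ell})=s_{i_{\ell+1}}$ for $\ell=1,\dots,m$ (indices modulo $m$, so $\sigma(o_{i_m})=s_{i_1}$); i.e., they form a directed cycle in the digraph with arcs $(s_i,i),(i,o_i),(o_i,\sigma(o_i))$. Writing $f_i=c(i,s_i)$ and $f^*_i=c(i,o_i)$, we have $$0\le\sum_{\ell=1}^m\Bigl(-f_{i_\ell}+f^*_{i_\ell}+c\bigl(o_{i_\ell},\sigma(o_{i_\ell})\bigr)\Bigr).$$ -}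

module Defs where

open import Level using (Level; suc; _⊔_)
open import Data.Nat as ℕ using (ℕ; zero) renaming (suc to sucℕ)
open import Data.Nat.DivMod using (_%_; m%n<n)
open import Data.Fin using (Fin; toℕ; fromℕ<) renaming (zero to fzero; suc to fsuc)
open import Data.Fin.Permutation using (Permutation′; _⟨$⟩ʳ_)
open import Data.Product using (∃)
open import Data.Sum using (_⊎_)
open import Relation.Binary.PropositionalEquality using (_≡_)

-- Distance values: a totally ordered abelian group (equality is _≡_).
-- The reals (ℝ, +, 0, -, ≤) are an instance; the stdlib has no reals,
-- so we state the result for every such value domain.
record OrderedAbelianGroup (a ℓ : Level) : Set (suc (a ⊔ ℓ)) where
  infixl 6 _+_
  infix  4 _≤_
  field
    Carrier   : Set a
    _+_       : Carrier → Carrier → Carrier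
    0#        : Carrier
    -_        : Carrier → Carrier
    _≤_       : Carrier → Carrier → Set ℓ
    +-assoc   : ∀ x y z → (x + y) + z ≡ x + (y + z)
    +-comm    : ∀ x y → x + y ≡ y + x
    +-identityˡ : ∀ x → 0# + x ≡ x
    -‿inverseˡ : ∀ x → (- x) + x ≡ 0#
    ≤-refl    : ∀ {x} → x ≤ x
    ≤-trans   : ∀ {x y z} → x ≤ y → y ≤ z → x ≤ z
    ≤-antisym : ∀ {x y} → x ≤ y → y ≤ x → x ≡ y
    ≤-total   : ∀ x y → x ≤ y ⊎ y ≤ x
    +-monoˡ-≤ : ∀ {x y} z → x ≤ y → x + z ≤ y + z

module _ {a ℓ} (G : OrderedAbelianGroup a ℓ) where
  open OrderedAbelianGroup G

  Σ : ∀ {m} → (Fin m → Carrier) → Carrier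
  Σ {zero}   f = 0#
  Σ {sucℕ m} f = f fzero + Σ (λ i → f (fsuc i))

  record IsMetric {v} {V : Set v} (c : V → V → Carrier) : Set (a ⊔ ℓ ⊔ v) where
    field
      nonneg   : ∀ x y → 0# ≤ c x y
      self     : ∀ x → c x x ≡ 0#
      zero⇒eq  : ∀ x y → c x y ≡ 0# → x ≡ y
      sym      : ∀ x y → c x y ≡ c y x
      triangle : ∀ x y z → c x z ≤ c x y + c y z

  -- i ↦ s i is a minimum-cost perfect matching between the facilities
  -- fac : Fin k → V and the locations s : Fin k → V: no perfect matching
  -- (i ↦ s (π i), π a permutation) has smaller total cost.
  IsMinCostMatching : ∀ {v} {V : Set v} (c : V → V → Carrier) {k}
                      (fac s : Fin k → V) → Set ℓ
  IsMinCostMatching c {k} fac s =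
    ∀ (π : Permutation′ k) →
      Σ (λ i → c (fac i) (s i)) ≤ Σ (λ i → c (fac i) (s (π ⟨$⟩ʳ i)))

  IsNearestMap : ∀ {v} {V : Set v} (c : V → V → Carrier) {k}
                 (s : Fin k → V) (σ : V → V) → Set (ℓ ⊔ v)
  IsNearestMap c s σ =
    ∀ x → (∃ λ j → σ x ≡ s j) × (∀ j → c x (σ x) ≤ c x (s j))
    where open import Data.Product using (_×_)

next : ∀ {n} → Fin (sucℕ n) → Fin (sucℕ n)
next {n} i = fromℕ< (m%n<n (sucℕ (toℕ i)) (sucℕ n))

-- Rerouting the matching along the cycle (facility i_ℓ to s_{i_{ℓ+1}}, every
-- other facility unchanged) gives another perfect matching, so minimality yields
-- Σ c(i_ℓ, s_{i_ℓ}) ≤ Σ c(i_ℓ, s_{i_{ℓ+1}}); and s_{i_{ℓ+1}} = σ(o_{i_ℓ}), so the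
-- triangle inequality bounds c(i_ℓ, s_{i_{ℓ+1}}) by f*_{i_ℓ} + c(o_{i_ℓ}, σ(o_{i_ℓ})).
module Submission where

open import Defs
open import Data.Nat as ℕ using (ℕ; suc; s≤s)
open import Data.Fin using (Fin)
open import Function.Definitions using (Injective)
open import Relation.Binary.PropositionalEquality using (_≡_)

open import Algebra.Bundles using (CommutativeMonoid)
import Algebra.Properties.CommutativeMonoid.Sum as CommutativeMonoidSum
import Algebra.Structures.Biased as Biased
open import Data.Fin using (zero; suc; toℕ; fromℕ; inject₁; punchIn; punchOut; _≟_)
open import Data.Fin.Permutation using (Permutation′; _⟨$⟩ʳ_; _⟨$⟩ˡ_; permutation; inverseˡ; inverseʳ)
open import Data.Fin.Properties
  using (toℕ-injective; toℕ-fromℕ<; toℕ-fromℕ; toℕ-inject₁; toℕ<n; suc-injective; any?;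
         punchInᵢ≢i; punchIn-punchOut; punchOut-punchIn; punchOut-cong; punchOut-injective)
open import Data.Nat.DivMod using (_%_; m<n⇒m%n≡m; n%n≡0)
open import Data.Product using (∃; _,_)
open import Data.Sum using (_⊎_; inj₁; inj₂)
open import Function using (_∘_)
open import Relation.Binary.PropositionalEquality
  using (_≢_; refl; sym; trans; cong; cong₂; subst; subst₂; module ≡-Reasoning)
open import Relation.Binary.PropositionalEquality.Algebra using (isMagma)
open import Relation.Nullary using (yes; no; contradiction)

prev : ∀ {n} → Fin (suc n) → Fin (suc n)
prev {n} zero    = fromℕ n
prev     (suc i) = inject₁ i

next-fromℕ : ∀ n → next (fromℕ n) ≡ zero
next-fromℕ n = toℕ-injective (begin
  toℕ (next (fromℕ n))        ≡⟨ toℕ-fromℕ< _ ⟩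
  suc (toℕ (fromℕ n)) % suc n ≡⟨ cong (λ x → suc x % suc n) (toℕ-fromℕ n) ⟩
  suc n % suc n               ≡⟨ n%n≡0 (suc n) ⟩
  0                           ∎)
  where open ≡-Reasoning

next-inject₁ : ∀ {n} (i : Fin n) → next (inject₁ i) ≡ suc i
next-inject₁ {n} i = toℕ-injective (begin
  toℕ (next (inject₁ i))        ≡⟨ toℕ-fromℕ< _ ⟩
  suc (toℕ (inject₁ i)) % suc n ≡⟨ cong (λ x → suc x % suc n) (toℕ-inject₁ i) ⟩
  suc (toℕ i) % suc n           ≡⟨ m<n⇒m%n≡m (s≤s (toℕ<n i)) ⟩
  suc (toℕ i)                   ∎)
  where open ≡-Reasoning

fromℕ-or-inject₁ : ∀ {n} (l : Fin (suc n)) → l ≡ fromℕ n ⊎ ∃ λ i → l ≡ inject₁ i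
fromℕ-or-inject₁ {ℕ.zero} zero = inj₁ refl
fromℕ-or-inject₁ {suc n}         zero = inj₂ (zero , refl)
fromℕ-or-inject₁ {suc n} (suc l) with fromℕ-or-inject₁ l
... | inj₁ l≡n       = inj₁ (cong suc l≡n)
... | inj₂ (i , l≡i) = inj₂ (suc i , cong suc l≡i)

next-prev : ∀ {n} (l : Fin (suc n)) → next (prev l) ≡ l
next-prev {n} zero = next-fromℕ n
next-prev (suc i)  = next-inject₁ i

prev-next : ∀ {n} (l : Fin (suc n)) → prev (next l) ≡ l
prev-next {n} l with fromℕ-or-inject₁ l
... | inj₁ refl       = cong prev (next-fromℕ n)
... | inj₂ (i , refl) = cong prev (next-inject₁ i)

rotation : ∀ n → Permutation′ (suc n)
rotation n = permutation next prev next-prev prev-next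

module _ {m k} (idx : Fin m → Fin k) (idx-injective : Injective _≡_ _≡_ idx) where

  extend : (Fin m → Fin m) → Fin k → Fin k
  extend f j with any? (λ l → idx l ≟ j)
  ... | yes (l , _) = idx (f l)
  ... | no _        = j

  extend-image : ∀ f l → extend f (idx l) ≡ idx (f l)
  extend-image f l with any? (λ l′ → idx l′ ≟ idx l)
  ... | yes (l′ , l′≡l) = cong (idx ∘ f) (idx-injective l′≡l)
  ... | no ∄l           = contradiction (l , refl) ∄l

  extend-outside : ∀ f j → (∀ l → idx l ≢ j) → extend f j ≡ j
  extend-outside f j j∉idx with any? (λ l → idx l ≟ j)
  ... | yes (l , l↦j) = contradiction l↦j (j∉idx l)
  ... | no _          = refl

  extend-inverse : ∀ f g → (∀ l → g (f l) ≡ l) → ∀ j → extend g (extend f j) ≡ j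
  extend-inverse f g g∘f≡id j with any? (λ l → idx l ≟ j)
  ... | yes (l , refl) = trans (extend-image g (f l)) (cong idx (g∘f≡id l))
  ... | no ∄l          = extend-outside g j (λ l l↦j → ∄l (l , l↦j))

  extendPermutation : Permutation′ m → Permutation′ k
  extendPermutation ρ = permutation (extend (ρ ⟨$⟩ʳ_)) (extend (ρ ⟨$⟩ˡ_))
    (extend-inverse (ρ ⟨$⟩ˡ_) (ρ ⟨$⟩ʳ_) (λ _ → inverseʳ ρ))
    (extend-inverse (ρ ⟨$⟩ʳ_) (ρ ⟨$⟩ˡ_) (λ _ → inverseˡ ρ))

module _ {c ℓ} (M : CommutativeMonoid c ℓ) where
  open CommutativeMonoid M using (Carrier; _≈_; setoid)
    renaming (_∙_ to _+_; ε to 0#; ∙-congˡ to +-congˡ; trans to ≈-trans)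
  open CommutativeMonoidSum M using (sum; sum-remove; sum-cong-≋; sum-cong-≗; sum-replicate-zero)

  sum-image : ∀ {m k} (idx : Fin m → Fin k) → Injective _≡_ _≡_ idx →
              (h : Fin k → Carrier) → (∀ j → (∀ l → idx l ≢ j) → h j ≈ 0#) →
              sum h ≈ sum (h ∘ idx)
  sum-image {ℕ.zero} {k} idx _ h h-outside =
    ≈-trans (sum-cong-≋ (λ j → h-outside j λ ())) (sum-replicate-zero k)
  sum-image {suc m} {ℕ.zero} idx _ _ _ with idx zero
  ... | ()
  sum-image {suc m} {suc k} idx idx-injective h h-outside = begin
    sum h                                 ≈⟨ sum-remove {i = i} h ⟩
    h i + sum (h ∘ punchIn i)             ≈⟨ +-congˡ (sum-image idx′ idx′-injective (h ∘ punchIn i) h′-outside) ⟩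
    h i + sum (h ∘ punchIn i ∘ idx′)      ≡⟨ cong (h i +_) (sum-cong-≗ (cong h ∘ punchIn-punchOut ∘ i≢idx-suc)) ⟩
    sum (h ∘ idx)                         ∎
    where
    open import Relation.Binary.Reasoning.Setoid setoid
    i = idx zero
    i≢idx-suc : ∀ l → i ≢ idx (suc l)
    i≢idx-suc l eq with idx-injective eq
    ... | ()
    idx′ : Fin m → Fin k
    idx′ l = punchOut (i≢idx-suc l)
    idx′-injective : Injective _≡_ _≡_ idx′
    idx′-injective eq = suc-injective (idx-injective (punchOut-injective (i≢idx-suc _) (i≢idx-suc _) eq))
    h′-outside : ∀ j → (∀ l → idx′ l ≢ j) → h (punchIn i j) ≈ 0#
    h′-outside j j∉idx′ = h-outside (punchIn i j) λ
      { zero    i↦j → punchInᵢ≢i i j (sym i↦j)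
      ; (suc l) l↦j → j∉idx′ l (trans (punchOut-cong i l↦j) (punchOut-punchIn i)) }

module _ {a ℓ} (G : OrderedAbelianGroup a ℓ) where
  open OrderedAbelianGroup G

  +-commutativeMonoid : CommutativeMonoid a a
  +-commutativeMonoid = record
    { Carrier             = Carrier
    ; _≈_                 = _≡_
    ; _∙_                 = _+_
    ; ε                   = 0#
    ; isCommutativeMonoid = Biased.isCommutativeMonoidˡ record
      { isSemigroup = record { isMagma = isMagma _+_ ; assoc = +-assoc }
      ; identityˡ   = +-identityˡ
      ; comm        = +-comm
      }
    }

  open CommutativeMonoidSum +-commutativeMonoid using (sum; sum-cong-≗; ∑-distrib-+)

  Σ≡sum : ∀ {m} (f : Fin m → Carrier) → Σ G f ≡ sum f
  Σ≡sum {ℕ.zero} f = refl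
  Σ≡sum {suc m}    f = cong (f zero +_) (Σ≡sum (f ∘ suc))

  +-monoʳ-≤ : ∀ z {x y} → x ≤ y → z + x ≤ z + y
  +-monoʳ-≤ z {x} {y} x≤y = subst₂ _≤_ (+-comm x z) (+-comm y z) (+-monoˡ-≤ z x≤y)

  Σ-mono-≤ : ∀ {m} {f g : Fin m → Carrier} → (∀ i → f i ≤ g i) → Σ G f ≤ Σ G g
  Σ-mono-≤ {ℕ.zero} _ = ≤-refl
  Σ-mono-≤ {suc m} {f} {g} f≤g =
    ≤-trans (+-monoˡ-≤ _ (f≤g zero)) (+-monoʳ-≤ (g zero) (Σ-mono-≤ (f≤g ∘ suc)))

  -x+[x+y]≡y : ∀ x y → - x + (x + y) ≡ y
  -x+[x+y]≡y x y = begin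
    - x + (x + y) ≡⟨ sym (+-assoc (- x) x y) ⟩
    - x + x + y   ≡⟨ cong (_+ y) (-‿inverseˡ x) ⟩
    0# + y        ≡⟨ +-identityˡ y ⟩
    y             ∎
    where open ≡-Reasoning

  x+[-x+y]≡y : ∀ x y → x + (- x + y) ≡ y
  x+[-x+y]≡y x y = begin
    x + (- x + y) ≡⟨ sym (+-assoc x (- x) y) ⟩
    x + - x + y   ≡⟨ cong (_+ y) (+-comm x (- x)) ⟩
    - x + x + y   ≡⟨ +-assoc (- x) x y ⟩
    - x + (x + y) ≡⟨ -x+[x+y]≡y x y ⟩
    y             ∎
    where open ≡-Reasoning

  x≤x+y⇒0≤y : ∀ {x y} → x ≤ x + y → 0# ≤ y
  x≤x+y⇒0≤y {x} {y} x≤x+y = subst₂ _≤_ (-‿inverseˡ x) (-x+[x+y]≡y x y) (+-monoʳ-≤ (- x) x≤x+y)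

  module _ {v} {V : Set v} (c : V → V → Carrier) {k} {fac s : Fin k → V}
           (minCost : IsMinCostMatching G c fac s) where

    minCostMatching-reroute :
      ∀ {m} (idx : Fin m → Fin k) → Injective _≡_ _≡_ idx → (ρ : Permutation′ m) →
      0# ≤ Σ G (λ l → - c (fac (idx l)) (s (idx l)) + c (fac (idx l)) (s (idx (ρ ⟨$⟩ʳ l))))
    minCostMatching-reroute {m} idx idx-injective ρ = subst (0# ≤_) Σgain≡ (x≤x+y⇒0≤y Σcost≤Σcost+Σgain)
      where
      π : Permutation′ k
      π = extendPermutation idx idx-injective ρ
      cost cost′ gain : Fin k → Carrier
      cost j  = c (fac j) (s j)
      cost′ j = c (fac j) (s (π ⟨$⟩ʳ j))
      gain j  = - cost j + cost′ j
      rerouted : Fin m → Carrier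
      rerouted l = - cost (idx l) + c (fac (idx l)) (s (idx (ρ ⟨$⟩ʳ l)))

      Σcost≤Σcost+Σgain : Σ G cost ≤ Σ G cost + Σ G gain
      Σcost≤Σcost+Σgain = subst (Σ G cost ≤_) (begin
        Σ G cost′                   ≡⟨ Σ≡sum cost′ ⟩
        sum cost′                   ≡⟨ sum-cong-≗ (λ j → sym (x+[-x+y]≡y (cost j) (cost′ j))) ⟩
        sum (λ j → cost j + gain j) ≡⟨ ∑-distrib-+ cost gain ⟩
        sum cost + sum gain         ≡⟨ cong₂ _+_ (Σ≡sum cost) (Σ≡sum gain) ⟨
        Σ G cost + Σ G gain         ∎) (minCost π)
        where open ≡-Reasoning

      gain-outside : ∀ j → (∀ l → idx l ≢ j) → gain j ≡ 0#
      gain-outside j j∉idx = trans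
        (cong (λ i → - cost j + c (fac j) (s i)) (extend-outside idx idx-injective _ j j∉idx))
        (-‿inverseˡ (cost j))

      Σgain≡ : Σ G gain ≡ Σ G rerouted
      Σgain≡ = begin
        Σ G gain         ≡⟨ Σ≡sum gain ⟩
        sum gain         ≡⟨ sum-image +-commutativeMonoid idx idx-injective gain gain-outside ⟩
        sum (gain ∘ idx) ≡⟨ sum-cong-≗ (λ l → cong (λ i → - cost (idx l) + c (fac (idx l)) (s i))
                                                    (extend-image idx idx-injective _ l)) ⟩
        sum rerouted     ≡⟨ Σ≡sum rerouted ⟨
        Σ G rerouted     ∎
        where open ≡-Reasoning

lemma3p3 : ∀ {a ℓ v} (G : OrderedAbelianGroup a ℓ) → let open OrderedAbelianGroup G in
    (V : Set v) (c : V → V → Carrier) → IsMetric G c →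
    (k : ℕ) (fac : Fin k → V) → Injective _≡_ _≡_ fac →
    (s : Fin k → V) → Injective _≡_ _≡_ s →
    IsMinCostMatching G c fac s →
    (o : Fin k → V) (σ : V → V) → IsNearestMap G c s σ →
    (n : ℕ) (idx : Fin (suc n) → Fin k) → Injective _≡_ _≡_ idx →
    (∀ l → σ (o (idx l)) ≡ s (idx (next l))) →
    0# ≤ Σ G (λ l → (- c (fac (idx l)) (s (idx l))) + c (fac (idx l)) (o (idx l)) + c (o (idx l)) (σ (o (idx l))))
lemma3p3 G V c metric k fac _ s _ minCost o σ _ n idx idx-injective cycle =
  ≤-trans (minCostMatching-reroute G c minCost idx idx-injective (rotation n)) (Σ-mono-≤ G detour)
  where
  open OrderedAbelianGroup G
  open IsMetric metric using (triangle)

  detour : ∀ l → - c (fac (idx l)) (s (idx l)) + c (fac (idx l)) (s (idx (next l)))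
                 ≤ - c (fac (idx l)) (s (idx l)) + c (fac (idx l)) (o (idx l)) + c (o (idx l)) (σ (o (idx l)))
  detour l = subst₂ _≤_
    (cong (λ t → - c (fac (idx l)) (s (idx l)) + c (fac (idx l)) t) (cycle l))
    (sym (+-assoc _ _ _))
    (+-monoʳ-≤ G _ (triangle (fac (idx l)) (o (idx l)) (σ (o (idx l)))))
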